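{- Let $m\ge1$, $q=2^m$, $s\ge1$, and for $\mu\in\mathbb{F}_{q^3}$ let $f_\mu^{(s)}(x)=x^{2^sq}+\mu x^{2^s}+x$. Let \[M_s=\max_{\mu\in\mathbb{F}_{q^3}}\dim_{\mathbb{F}_2}\ker(f_\mu^{(s)}).\] Suppose that there are at least $N_s$ pairs $(x,y)\in(\mathbb{F}_{q^3}^*)^2$ with $x\neq y$ and $\frac{x^{2^sq}+x}{x^{2^s}}=\frac{y^{2^sq}+y}{y^{2^s}}$. Then there are at least $1+\frac{N_s}{2^{M_s}-1}$ elements $\mu\in\mathbb{F}_{q^3}$ for which $f_\mu^{(s)}(x)$ is a permutation of $\mathbb{F}_{q^3}$.
   Context: $\ker(f_\mu^{(s)})$ is the $\mathbb{F}_2$-subspace of roots of $f_\mu^{(s)}$ in $\mathbb{F}_{q^3}$. The pairs in the hypothesis are what the paper calls the $\mathbb{F}_{q^3}$-rational points of the curve $\mathcal{C}_s: \frac{Y^{2^s}(X^{2^sq}+X)+X^{2^s}(Y^{2^sq}+Y)}{X+Y}=0$. -}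

module Defs where

open import Level using (0ℓ)
open import Data.Nat as ℕ using (ℕ; zero; suc)
open import Data.Nat.Logarithm using (⌊log₂_⌋)
open import Data.Fin as Fin using (Fin)
open import Data.Bool using (Bool; true; false)
open import Data.Product using (Σ; ∃; _×_; _,_)
open import Relation.Nullary using (¬_; Dec; yes; no)
open import Relation.Binary using (Decidable)
open import Relation.Binary.PropositionalEquality using (_≡_)
open import Algebra.Bundles using (CommutativeRing)

record FiniteField2 (order : ℕ) : Set₁ where
  field
    cring : CommutativeRing 0ℓ 0ℓ
  open CommutativeRing cring public hiding (ring)
  field
    0≉1     : ¬ (0# ≈ 1#)
    _⁻¹     : Carrier → Carrier
    ⁻¹-cong : ∀ {x y} → x ≈ y → (x ⁻¹) ≈ (y ⁻¹)
    inverse : ∀ x → ¬ (x ≈ 0#) → (x * (x ⁻¹)) ≈ 1#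
    char2   : (1# + 1#) ≈ 0#
    _≟_     : Decidable _≈_
    enum      : Fin order → Carrier
    enum-inj  : ∀ i j → enum i ≈ enum j → i ≡ j
    enum-surj : ∀ x → ∃ λ i → enum i ≈ x

countFin : (n : ℕ) → (Fin n → Bool) → ℕ
countFin zero    p = 0
countFin (suc n) p with p Fin.zero
... | true  = suc (countFin n (λ i → p (Fin.suc i)))
... | false = countFin n (λ i → p (Fin.suc i))

maxFin : (n : ℕ) → (Fin n → ℕ) → ℕ
maxFin zero    g = 0
maxFin (suc n) g = g Fin.zero ℕ.⊔ maxFin n (λ i → g (Fin.suc i))

module FieldNotions {order : ℕ} (F : FiniteField2 order) where
  open FiniteField2 F

  pow : Carrier → ℕ → Carrier
  pow x zero    = 1#
  pow x (suc n) = x * pow x n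

  f : (m s : ℕ) → Carrier → Carrier → Carrier
  f m s μ x = (pow x (2 ℕ.^ s ℕ.* 2 ℕ.^ m) + μ * pow x (2 ℕ.^ s)) + x

  isZeroB : Carrier → Bool
  isZeroB x with x ≟ 0#
  ... | yes _ = true
  ... | no  _ = false

  kerSize : (m s : ℕ) → Carrier → ℕ
  kerSize m s μ = countFin order (λ i → isZeroB (f m s μ (enum i)))

  -- dim_{F_2} ker f_μ^{(s)} = log₂ |ker f_μ^{(s)}|
  -- (the kernel is an F_2-subspace, so its size is a power of 2)
  kerDim : (m s : ℕ) → Carrier → ℕ
  kerDim m s μ = ⌊log₂ kerSize m s μ ⌋

  Ms : (m s : ℕ) → ℕ
  Ms m s = maxFin order (λ i → kerDim m s (enum i))

  IsPermutation : (Carrier → Carrier) → Set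
  IsPermutation g = (∀ x y → g x ≈ g y → x ≈ y) × (∀ y → ∃ λ x → g x ≈ y)

  ratio : (m s : ℕ) → Carrier → Carrier
  ratio m s x = (pow x (2 ℕ.^ s ℕ.* 2 ℕ.^ m) + x) * (pow x (2 ℕ.^ s) ⁻¹)

  CurvePair : (m s : ℕ) → Carrier → Carrier → Set
  CurvePair m s x y =
    ¬ (x ≈ 0#) × ¬ (y ≈ 0#) × ¬ (x ≈ y) × (ratio m s x ≈ ratio m s y)

module Submission where

-- f_μ is additive (a sum of Frobenius powers and the identity), so its roots form an F₂-subspace:
-- there are 2^d of them with d ≤ M_s, and f_μ permutes the field iff 0 is its only root. A nonzero
-- x is a root of f_μ exactly when μ = (x^(2^s q) + x) / x^(2^s), so the numbers c_μ of nonzero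
-- roots partition the q³ − 1 nonzero elements and satisfy c_μ ≤ 2^M_s − 1. The given pairs are
-- pairs of distinct points in a common fibre of this ratio map, hence
--   N ≤ Σ_μ c_μ (c_μ − 1) ≤ (2^M_s − 1) Σ_μ (c_μ ∸ 1) = (2^M_s − 1) (K − 1),
-- where K counts the μ with c_μ = 0, that is, the μ for which f_μ is a permutation.

open import Algebra.Core using (Op₂)
open import Algebra.Structures using (IsCommutativeMonoid)
open import Data.Fin using (Fin)
open import Data.Nat using (ℕ)
open import Relation.Binary.PropositionalEquality using (_≡_)
open import Defs
import Data.Nat.Properties

module FiniteSums where

  open import Algebra.Properties.CommutativeSemigroup Data.Nat.Properties.+-commutativeSemigroup using (x∙yz≈y∙xz)
  open import Algebra.Properties.Semiring.Sum Data.Nat.Properties.+-*-semiring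
    using (sum; sum-syntax; ∑-distrib-+; ∑-comm; sum-cong-≗; sum-remove; sum-replicate-zero; *-distribˡ-sum; *-distribʳ-sum)
  open import Data.Bool using (Bool; true; false; not; T)
  open import Data.Bool.Properties using (T-≡)
  open import Data.Fin using (zero; suc; punchIn; punchOut)
  open import Data.Fin.Properties using (_≟_; any?; punchInᵢ≢i; punchOut-injective; injective⇒≤; 0≢1+n; suc-injective)
  open import Data.Nat using (zero; suc; _+_; _*_; _∸_; _≤_; _≡ᵇ_; z≤n; s≤s)
  open import Data.Nat.Properties
    using (1+n≰n; m≤m⊔n; m≤n⊔m; ≤-trans; +-cancelˡ-≡; *-suc; +-monoˡ-≤; *-monoˡ-≤; m≤m+n; +-comm; +-identityʳ;
           *-identityʳ; *-comm; *-assoc; *-distribˡ-+; +-mono-≤; m∸n+n≡m; m+n∸n≡m; module ≤-Reasoning)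
  open import Data.Product using (Σ; ∃; _×_; _,_; uncurry)
  open import Function using (_∘_; Injective)
  open import Function.Bundles using (module Equivalence)
  open import Relation.Nullary using (yes; no; contradiction)
  open import Relation.Nullary.Decidable using (⌊_⌋)
  open import Relation.Binary.PropositionalEquality
  open Equivalence using (from)

  private variable
    n : ℕ

  𝟙 : Bool → ℕ
  𝟙 true  = 1
  𝟙 false = 0

  𝟙+𝟙-not : ∀ b → 𝟙 b + 𝟙 (not b) ≡ 1
  𝟙+𝟙-not true  = refl
  𝟙+𝟙-not false = refl

  δ ν : Fin n → Fin n → ℕ
  δ i j = 𝟙 ⌊ i ≟ j ⌋
  ν i j = 𝟙 (not ⌊ i ≟ j ⌋)

  δ-refl : (i : Fin n) → δ i i ≡ 1
  δ-refl i with i ≟ i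
  ... | yes _   = refl
  ... | no  i≢i = contradiction refl i≢i

  δ-≢ : {i j : Fin n} → i ≢ j → δ i j ≡ 0
  δ-≢ {i = i} {j} i≢j with i ≟ j
  ... | yes i≡j = contradiction i≡j i≢j
  ... | no  _   = refl

  ν-≢ : {i j : Fin n} → i ≢ j → ν i j ≡ 1
  ν-≢ {i = i} {j} i≢j with i ≟ j
  ... | yes i≡j = contradiction i≡j i≢j
  ... | no  _   = refl

  ν≤1 : (i j : Fin n) → ν i j ≤ 1
  ν≤1 i j with i ≟ j
  ... | yes _ = z≤n
  ... | no  _ = s≤s z≤n

  δ+ν : (i j : Fin n) → δ i j + ν i j ≡ 1
  δ+ν i j = 𝟙+𝟙-not ⌊ i ≟ j ⌋

  countFin≡∑ : ∀ n (p : Fin n → Bool) → countFin n p ≡ ∑[ i < n ] 𝟙 (p i)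
  countFin≡∑ zero    p = refl
  countFin≡∑ (suc n) p with p zero
  ... | true  = cong suc (countFin≡∑ n (p ∘ suc))
  ... | false = countFin≡∑ n (p ∘ suc)

  ≤-maxFin : ∀ n (g : Fin n → ℕ) i → g i ≤ maxFin n g
  ≤-maxFin (suc n) g zero    = m≤m⊔n (g zero) _
  ≤-maxFin (suc n) g (suc i) = ≤-trans (≤-maxFin n (g ∘ suc) i) (m≤n⊔m (g zero) _)

  ∑-mono-≤ : {f g : Fin n → ℕ} → (∀ i → f i ≤ g i) → sum f ≤ sum g
  ∑-mono-≤ {zero}  f≤g = z≤n
  ∑-mono-≤ {suc n} f≤g = +-mono-≤ (f≤g zero) (∑-mono-≤ (f≤g ∘ suc))

  ≤-∑ : (f : Fin n → ℕ) (i : Fin n) → f i ≤ sum f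
  ≤-∑ {suc n} f i = subst (f i ≤_) (sym (sum-remove {i = i} f)) (m≤m+n (f i) _)

  ∑-zero : {f : Fin n → ℕ} → (∀ i → f i ≡ 0) → sum f ≡ 0
  ∑-zero {n} f≡0 = trans (sum-cong-≗ f≡0) (sum-replicate-zero n)

  ∑-one : ∀ n → ∑[ i < n ] 1 ≡ n
  ∑-one zero    = refl
  ∑-one (suc n) = cong suc (∑-one n)

  ∑-δ : (j : Fin n) (g : Fin n → ℕ) → ∑[ i < n ] (δ j i * g i) ≡ g j
  ∑-δ {suc n} j g = begin
    ∑[ i < suc n ] (δ j i * g i)                        ≡⟨ sum-remove {i = j} (λ i → δ j i * g i) ⟩
    δ j j * g j + ∑[ k < n ] (δ j (punchIn j k) * g (punchIn j k))
      ≡⟨ cong₂ _+_ (cong (_* g j) (δ-refl j)) (∑-zero (λ k → cong (_* g (punchIn j k)) (δ-≢ (punchInᵢ≢i j k ∘ sym)))) ⟩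
    g j + 0 + 0                                         ≡⟨ trans (+-identityʳ _) (+-identityʳ _) ⟩
    g j                                                 ∎
    where open ≡-Reasoning

  ∑-δ-one : (j : Fin n) → ∑[ i < n ] δ j i ≡ 1
  ∑-δ-one {n} j = trans (sum-cong-≗ (λ i → sym (*-identityʳ (δ j i)))) (∑-δ j (λ _ → 1))

  ∑-ν+1≡n : (j : Fin n) → ∑[ x < n ] ν j x + 1 ≡ n
  ∑-ν+1≡n {n} j = begin
    ∑[ x < n ] ν j x + 1                       ≡⟨ cong (∑[ x < n ] ν j x +_) (∑-δ-one j) ⟨
    ∑[ x < n ] ν j x + ∑[ x < n ] δ j x        ≡⟨ ∑-distrib-+ (ν j) (δ j) ⟨
    ∑[ x < n ] (ν j x + δ j x)                 ≡⟨ sum-cong-≗ {n} (λ x → trans (+-comm (ν j x) (δ j x)) (δ+ν j x)) ⟩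
    ∑[ x < n ] 1                               ≡⟨ ∑-one n ⟩
    n                                          ∎
    where open ≡-Reasoning

  enumerate : ∀ n (p : Fin n → Bool) →
    Σ (Fin (countFin n p) → Fin n) λ g → Injective _≡_ _≡_ g × (∀ i → T (p (g i)))
  enumerate zero    p = (λ ()) , (λ { {()} }) , (λ ())
  enumerate (suc n) p with p zero in p0 | enumerate n (p ∘ suc)
  ... | false | g , g-inj , g-ok = suc ∘ g , g-inj ∘ suc-injective , g-ok
  ... | true  | g , g-inj , g-ok = g′ , g′-inj , g′-ok
    where
    g′ : Fin (suc (countFin n (p ∘ suc))) → Fin (suc n)
    g′ zero    = zero
    g′ (suc i) = suc (g i)
    g′-inj : Injective _≡_ _≡_ g′
    g′-inj {zero}  {zero}  _  = refl
    g′-inj {suc i} {suc j} eq = cong suc (g-inj (suc-injective eq))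
    g′-ok : ∀ i → T (p (g′ i))
    g′-ok zero    = from T-≡ p0
    g′-ok (suc i) = g-ok i

  injective⇒surjective : {h : Fin n → Fin n} → Injective _≡_ _≡_ h → ∀ y → ∃ λ x → h x ≡ y
  injective⇒surjective {suc n} {h} h-inj y with any? (λ x → h x ≟ y)
  ... | yes hit = hit
  ... | no miss = contradiction (injective⇒≤ avoid-inj) 1+n≰n
    where
    y≢h : ∀ x → y ≢ h x
    y≢h x y≡hx = miss (x , sym y≡hx)
    avoid : Fin (suc n) → Fin n
    avoid x = punchOut (y≢h x)
    avoid-inj : Injective _≡_ _≡_ avoid
    avoid-inj {x₁} {x₂} eq = h-inj (punchOut-injective (y≢h x₁) (y≢h x₂) eq)

  module _ {a b : ℕ} where

    δ₂ : Fin a × Fin b → Fin a → Fin b → ℕ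
    δ₂ (x₀ , y₀) x y = δ x₀ x * δ y₀ y

    ∑∑-δ₂ : ∀ p → ∑[ x < a ] ∑[ y < b ] δ₂ p x y ≡ 1
    ∑∑-δ₂ (x₀ , y₀) = begin
      ∑[ x < a ] ∑[ y < b ] (δ x₀ x * δ y₀ y) ≡⟨ sum-cong-≗ (λ x → *-distribˡ-sum (δ x₀ x) (δ y₀)) ⟨
      ∑[ x < a ] (δ x₀ x * ∑[ y < b ] δ y₀ y) ≡⟨ sum-cong-≗ (λ x → cong (δ x₀ x *_) (∑-δ-one y₀)) ⟩
      ∑[ x < a ] (δ x₀ x * 1)                 ≡⟨ ∑-δ x₀ (λ _ → 1) ⟩
      1                                       ∎
      where open ≡-Reasoning

    δ₂-≢ : ∀ {p x y} → p ≢ (x , y) → δ₂ p x y ≡ 0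
    δ₂-≢ {x₀ , y₀} {x} {y} p≢xy with x₀ ≟ x | y₀ ≟ y
    ... | no _      | _         = refl
    ... | yes _     | no _      = refl
    ... | yes refl  | yes refl  = contradiction refl p≢xy

    δ₂-≤ : ∀ (W : Fin a → Fin b → ℕ) {p} → 1 ≤ uncurry W p → ∀ x y → δ₂ p x y ≤ W x y
    δ₂-≤ W {x₀ , y₀} 1≤Wp x y with x₀ ≟ x | y₀ ≟ y
    ... | no _      | _         = z≤n
    ... | yes _     | no _      = z≤n
    ... | yes refl  | yes refl  = 1≤Wp

    ∑∑-distrib-+ : (f g : Fin a → Fin b → ℕ) →
      ∑[ x < a ] ∑[ y < b ] (f x y + g x y) ≡ ∑[ x < a ] ∑[ y < b ] f x y + ∑[ x < a ] ∑[ y < b ] g x y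
    ∑∑-distrib-+ f g = trans (sum-cong-≗ {a} (λ x → ∑-distrib-+ (f x) (g x))) (∑-distrib-+ (λ x → ∑[ y < b ] f x y) (λ x → ∑[ y < b ] g x y))

    injective⇒≤-∑∑ : ∀ {N} (h : Fin N → Fin a × Fin b) → Injective _≡_ _≡_ h →
      (W : Fin a → Fin b → ℕ) → (∀ i → 1 ≤ uncurry W (h i)) → N ≤ ∑[ x < a ] ∑[ y < b ] W x y
    injective⇒≤-∑∑ {zero}  h inj W 1≤W = z≤n
    injective⇒≤-∑∑ {suc N} h inj W 1≤W = begin
      suc N                                                     ≤⟨ s≤s (injective⇒≤-∑∑ (h ∘ suc) (suc-injective ∘ inj) W′ 1≤W′) ⟩
      suc (∑∑ W′)                                               ≡⟨ +-comm 1 (∑∑ W′) ⟩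
      ∑∑ W′ + 1                                                 ≡⟨ cong (∑∑ W′ +_) (∑∑-δ₂ (h zero)) ⟨
      ∑∑ W′ + ∑∑ (δ₂ (h zero))                                  ≡⟨ ∑∑-distrib-+ W′ (δ₂ (h zero)) ⟨
      ∑[ x < a ] ∑[ y < b ] (W′ x y + δ₂ (h zero) x y)         ≡⟨ sum-cong-≗ (λ x → sum-cong-≗ (λ y → m∸n+n≡m (δ₂-≤ W (1≤W zero) x y))) ⟩
      ∑∑ W                                                      ∎
      where
      open ≤-Reasoning
      ∑∑ : (Fin a → Fin b → ℕ) → ℕ
      ∑∑ V = ∑[ x < a ] ∑[ y < b ] V x y
      W′ : Fin a → Fin b → ℕ
      W′ x y = W x y ∸ δ₂ (h zero) x y
      1≤W′ : ∀ i → 1 ≤ uncurry W′ (h (suc i))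
      1≤W′ i = subst (λ d → 1 ≤ uncurry W (h (suc i)) ∸ d) (sym (δ₂-≢ (0≢1+n ∘ inj))) (1≤W (suc i))

  n≤1⇒n*[m∸n]≡n*[m∸1] : ∀ m {n} → n ≤ 1 → n * (m ∸ n) ≡ n * (m ∸ 1)
  n≤1⇒n*[m∸n]≡n*[m∸1] m z≤n       = refl
  n≤1⇒n*[m∸n]≡n*[m∸1] m (s≤s z≤n) = refl

  module _ {n k : ℕ} (w : Fin n → ℕ) (ρ : Fin n → Fin k) where

    fibre : Fin k → ℕ
    fibre μ = ∑[ x < n ] (w x * δ (ρ x) μ)

    ∑-fibre : (g : Fin k → ℕ) → ∑[ x < n ] (w x * g (ρ x)) ≡ ∑[ μ < k ] (fibre μ * g μ)
    ∑-fibre g = begin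
      ∑[ x < n ] (w x * g (ρ x))                       ≡⟨ sum-cong-≗ (λ x → cong (w x *_) (∑-δ (ρ x) g)) ⟨
      ∑[ x < n ] (w x * ∑[ μ < k ] (δ (ρ x) μ * g μ))   ≡⟨ sum-cong-≗ {n} (λ x → *-distribˡ-sum (w x) (λ μ → δ (ρ x) μ * g μ)) ⟩
      ∑[ x < n ] ∑[ μ < k ] (w x * (δ (ρ x) μ * g μ))   ≡⟨ sum-cong-≗ {n} (λ x → sum-cong-≗ {k} (λ μ → *-assoc (w x) (δ (ρ x) μ) (g μ))) ⟨
      ∑[ x < n ] ∑[ μ < k ] (w x * δ (ρ x) μ * g μ)     ≡⟨ ∑-comm (λ x μ → w x * δ (ρ x) μ * g μ) ⟩
      ∑[ μ < k ] ∑[ x < n ] (w x * δ (ρ x) μ * g μ)     ≡⟨ sum-cong-≗ {k} (λ μ → *-distribʳ-sum (g μ) (λ x → w x * δ (ρ x) μ)) ⟨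
      ∑[ μ < k ] (fibre μ * g μ)                        ∎
      where open ≡-Reasoning

    ∑-fibre-total : ∑[ μ < k ] fibre μ ≡ ∑[ x < n ] w x
    ∑-fibre-total = begin
      ∑[ μ < k ] fibre μ          ≡⟨ sum-cong-≗ {k} (λ μ → *-identityʳ (fibre μ)) ⟨
      ∑[ μ < k ] (fibre μ * 1)    ≡⟨ ∑-fibre (λ _ → 1) ⟨
      ∑[ x < n ] (w x * 1)        ≡⟨ sum-cong-≗ {n} (λ x → *-identityʳ (w x)) ⟩
      ∑[ x < n ] w x              ∎
      where open ≡-Reasoning

    sameFibre : Fin n → Fin n → ℕ
    sameFibre x y = w x * (w y * δ (ρ y) (ρ x) * ν x y)

    module _ (w≤1 : ∀ x → w x ≤ 1) where

      ∑-sameFibre : ∀ x → ∑[ y < n ] sameFibre x y ≡ w x * (fibre (ρ x) ∸ 1)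
      ∑-sameFibre x = begin
        ∑[ y < n ] sameFibre x y                       ≡⟨ *-distribˡ-sum (w x) (λ y → t y * ν x y) ⟨
        w x * ∑[ y < n ] (t y * ν x y)                 ≡⟨ cong (w x *_) (m+n∸n≡m _ (w x)) ⟨
        w x * (∑[ y < n ] (t y * ν x y) + w x ∸ w x)   ≡⟨ cong (λ m → w x * (m ∸ w x)) others+self ⟩
        w x * (fibre (ρ x) ∸ w x)                      ≡⟨ n≤1⇒n*[m∸n]≡n*[m∸1] (fibre (ρ x)) (w≤1 x) ⟩
        w x * (fibre (ρ x) ∸ 1)                        ∎
        where
        open ≡-Reasoning
        t : Fin n → ℕ
        t y = w y * δ (ρ y) (ρ x)
        split : ∀ y → t y * ν x y + δ x y * t y ≡ t y
        split y = begin
          t y * ν x y + δ x y * t y   ≡⟨ cong (t y * ν x y +_) (*-comm (δ x y) (t y)) ⟩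
          t y * ν x y + t y * δ x y   ≡⟨ *-distribˡ-+ (t y) (ν x y) (δ x y) ⟨
          t y * (ν x y + δ x y)       ≡⟨ cong (t y *_) (trans (+-comm (ν x y) (δ x y)) (δ+ν x y)) ⟩
          t y * 1                     ≡⟨ *-identityʳ (t y) ⟩
          t y                         ∎
        others+self : ∑[ y < n ] (t y * ν x y) + w x ≡ fibre (ρ x)
        others+self = begin
          ∑[ y < n ] (t y * ν x y) + w x                        ≡⟨ cong (∑[ y < n ] (t y * ν x y) +_) (trans (∑-δ x t) (trans (cong (w x *_) (δ-refl (ρ x))) (*-identityʳ (w x)))) ⟨
          ∑[ y < n ] (t y * ν x y) + ∑[ y < n ] (δ x y * t y)   ≡⟨ ∑-distrib-+ (λ y → t y * ν x y) (λ y → δ x y * t y) ⟨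
          ∑[ y < n ] (t y * ν x y + δ x y * t y)                ≡⟨ sum-cong-≗ {n} split ⟩
          fibre (ρ x)                                           ∎

      ∑∑-sameFibre : ∑[ x < n ] ∑[ y < n ] sameFibre x y ≡ ∑[ μ < k ] (fibre μ * (fibre μ ∸ 1))
      ∑∑-sameFibre = trans (sum-cong-≗ {n} ∑-sameFibre) (∑-fibre (λ μ → fibre μ ∸ 1))

  [n∸1]+1≡n+𝟙[n≡ᵇ0] : ∀ n → n ∸ 1 + 1 ≡ n + 𝟙 (n ≡ᵇ 0)
  [n∸1]+1≡n+𝟙[n≡ᵇ0] zero    = refl
  [n∸1]+1≡n+𝟙[n≡ᵇ0] (suc n) = trans (+-comm n 1) (sym (+-identityʳ (suc n)))

  ∑[∸1]+1≡#zeros : (c : Fin n → ℕ) → ∑[ μ < n ] c μ + 1 ≡ n →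
                   ∑[ μ < n ] (c μ ∸ 1) + 1 ≡ countFin n (λ μ → c μ ≡ᵇ 0)
  ∑[∸1]+1≡#zeros {n} c ∑c+1≡n = +-cancelˡ-≡ (sum c) _ _ (begin
    sum c + (X + 1)                               ≡⟨ x∙yz≈y∙xz (sum c) X 1 ⟩
    X + (sum c + 1)                               ≡⟨ cong (X +_) (trans ∑c+1≡n (sym (∑-one n))) ⟩
    X + ∑[ μ < n ] 1                              ≡⟨ ∑-distrib-+ (λ μ → c μ ∸ 1) (λ _ → 1) ⟨
    ∑[ μ < n ] (c μ ∸ 1 + 1)                      ≡⟨ sum-cong-≗ {n} (λ μ → [n∸1]+1≡n+𝟙[n≡ᵇ0] (c μ)) ⟩
    ∑[ μ < n ] (c μ + 𝟙 (c μ ≡ᵇ 0))               ≡⟨ ∑-distrib-+ c (λ μ → 𝟙 (c μ ≡ᵇ 0)) ⟩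
    sum c + ∑[ μ < n ] 𝟙 (c μ ≡ᵇ 0)               ≡⟨ cong (sum c +_) (countFin≡∑ n (λ μ → c μ ≡ᵇ 0)) ⟨
    sum c + countFin n (λ μ → c μ ≡ᵇ 0)           ∎)
    where
    open ≡-Reasoning
    X : ℕ
    X = ∑[ μ < n ] (c μ ∸ 1)

  ∑[c*[c∸1]]+D≤#zeros*D : (c : Fin n → ℕ) (D : ℕ) → (∀ μ → c μ ≤ D) → ∑[ μ < n ] c μ + 1 ≡ n →
                          ∑[ μ < n ] (c μ * (c μ ∸ 1)) + D ≤ countFin n (λ μ → c μ ≡ᵇ 0) * D
  ∑[c*[c∸1]]+D≤#zeros*D {n} c D c≤D ∑c+1≡n = begin
    ∑[ μ < n ] (c μ * (c μ ∸ 1)) + D   ≤⟨ +-monoˡ-≤ D (∑-mono-≤ (λ μ → *-monoˡ-≤ (c μ ∸ 1) (c≤D μ))) ⟩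
    ∑[ μ < n ] (D * (c μ ∸ 1)) + D     ≡⟨ cong (_+ D) (*-distribˡ-sum D (λ μ → c μ ∸ 1)) ⟨
    D * X + D                          ≡⟨ +-comm (D * X) D ⟩
    D + D * X                          ≡⟨ *-suc D X ⟨
    D * suc X                          ≡⟨ cong (D *_) (trans (+-comm 1 X) (∑[∸1]+1≡#zeros c ∑c+1≡n)) ⟩
    D * countFin n (λ μ → c μ ≡ᵇ 0)    ≡⟨ *-comm D _ ⟩
    countFin n (λ μ → c μ ≡ᵇ 0) * D    ∎
    where
    open ≤-Reasoning
    X : ℕ
    X = ∑[ μ < n ] (c μ ∸ 1)

module BooleanGroup {n : ℕ} {_∙_ : Op₂ (Fin n)} {ε : Fin n}
  (isCommutativeMonoid : IsCommutativeMonoid _≡_ _∙_ ε) (∙-self : ∀ x → x ∙ x ≡ ε) where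

  open import Level using (0ℓ)
  open import Algebra.Bundles using (CommutativeMonoid)
  open import Algebra.Properties.Semiring.Sum Data.Nat.Properties.+-*-semiring using (sum-syntax; ∑-distrib-+; sum-cong-≗; sum-permute)
  open import Data.Bool using (Bool; true; false; _∨_; T)
  open import Data.Bool.Properties using (T?; T-∨; T-≡)
  open import Data.Empty using (⊥-elim)
  open import Data.Fin.Permutation using (Permutation′; permutation)
  open import Data.Fin.Properties using (_≟_; any?)
  open import Data.Nat using (zero; suc; _+_; _^_; _≤_; z≤n; s≤s)
  open import Data.Nat.Properties using (≤-antisym; +-comm; +-identityʳ; m^n>0; +-suc; +-monoʳ-≤; +-monoˡ-≤; m≤n+m; ≤-trans; 1+n≰n)
  open import Data.Product using (∃; _,_)
  open import Data.Sum using (inj₁; inj₂)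
  open import Function using (_∘_)
  open import Function.Bundles using (module Equivalence)
  open import Relation.Nullary using (¬_; yes; no; ¬?; _×-dec_; contradiction)
  open import Relation.Nullary.Decidable using (⌊_⌋; toWitness; fromWitness)
  open import Relation.Binary.PropositionalEquality
  open Equivalence using (to; from)
  open FiniteSums using (𝟙; ∑-mono-≤; ∑-δ-one)

  open IsCommutativeMonoid isCommutativeMonoid using (assoc; identityʳ)

  private
    commutativeMonoid : CommutativeMonoid 0ℓ 0ℓ
    commutativeMonoid = record { isCommutativeMonoid = isCommutativeMonoid }

  open import Algebra.Solver.CommutativeMonoid commutativeMonoid using (solve; _⊕_; _⊜_)

  ∙-cancelʳ : ∀ x a → (x ∙ a) ∙ a ≡ x
  ∙-cancelʳ x a = trans (assoc x a a) (trans (cong (x ∙_) (∙-self a)) (identityʳ x))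

  translation : Fin n → Permutation′ n
  translation a = permutation (_∙ a) (_∙ a) (λ x → ∙-cancelʳ x a) (λ x → ∙-cancelʳ x a)

  ∣_∣ : (Fin n → Bool) → ℕ
  ∣ S ∣ = ∑[ x < n ] 𝟙 (S x)

  _⊆_ : (Fin n → Bool) → (Fin n → Bool) → Set
  S ⊆ U = ∀ x → T (S x) → T (U x)

  Closed : (Fin n → Bool) → Set
  Closed S = ∀ x y → T (S x) → T (S y) → T (S (x ∙ y))

  ∣∣-mono-⊆ : ∀ {S U} → S ⊆ U → ∣ S ∣ ≤ ∣ U ∣
  ∣∣-mono-⊆ {S} {U} S⊆U = ∑-mono-≤ (λ x → 𝟙-mono (S⊆U x))
    where
    𝟙-mono : ∀ {b c} → (T b → T c) → 𝟙 b ≤ 𝟙 c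
    𝟙-mono {false}         _   = z≤n
    𝟙-mono {true}  {true}  _   = s≤s z≤n
    𝟙-mono {true}  {false} b⇒c = ⊥-elim (b⇒c _)

  ∣∣-translate : ∀ S a → ∣ (λ x → S (x ∙ a)) ∣ ≡ ∣ S ∣
  ∣∣-translate S a = sym (sum-permute (𝟙 ∘ S) (translation a))

  adjoin : (Fin n → Bool) → Fin n → Fin n → Bool
  adjoin S a x = S x ∨ S (x ∙ a)

  module _ {S : Fin n → Bool} (S-closed : Closed S) (a : Fin n) where

    adjoin-closed : Closed (adjoin S a)
    adjoin-closed x y x∈ y∈ with to T-∨ x∈ | to T-∨ y∈
    ... | inj₁ x∈S  | inj₁ y∈S  = from T-∨ (inj₁ (S-closed x y x∈S y∈S))
    ... | inj₁ x∈S  | inj₂ ya∈S = from T-∨ (inj₂ (subst (T ∘ S) (sym (assoc x y a)) (S-closed x (y ∙ a) x∈S ya∈S)))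
    ... | inj₂ xa∈S | inj₁ y∈S  = from T-∨ (inj₂ (subst (T ∘ S) (solve 3 (λ x y a → (x ⊕ a) ⊕ y ⊜ (x ⊕ y) ⊕ a) refl x y a) (S-closed (x ∙ a) y xa∈S y∈S)))
    ... | inj₂ xa∈S | inj₂ ya∈S = from T-∨ (inj₁ (subst (T ∘ S) xa∙ya≡x∙y (S-closed (x ∙ a) (y ∙ a) xa∈S ya∈S)))
      where
      xa∙ya≡x∙y : (x ∙ a) ∙ (y ∙ a) ≡ x ∙ y
      xa∙ya≡x∙y = trans (solve 3 (λ x y a → (x ⊕ a) ⊕ (y ⊕ a) ⊜ ((x ⊕ y) ⊕ a) ⊕ a) refl x y a) (∙-cancelʳ (x ∙ y) a)

    adjoin-⊆ : ∀ {U} → Closed U → S ⊆ U → T (U a) → adjoin S a ⊆ U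
    adjoin-⊆ {U} U-closed S⊆U a∈U x x∈ with to T-∨ x∈
    ... | inj₁ x∈S  = S⊆U x x∈S
    ... | inj₂ xa∈S = subst (T ∘ U) (∙-cancelʳ x a) (U-closed (x ∙ a) a (S⊆U (x ∙ a) xa∈S) a∈U)

    ∣adjoin∣ : ¬ T (S a) → ∣ adjoin S a ∣ ≡ ∣ S ∣ + ∣ S ∣
    ∣adjoin∣ a∉S = begin
      ∣ adjoin S a ∣                                     ≡⟨ sum-cong-≗ {n} disjoint ⟩
      ∑[ x < n ] (𝟙 (S x) + 𝟙 (S (x ∙ a)))              ≡⟨ ∑-distrib-+ (𝟙 ∘ S) (λ x → 𝟙 (S (x ∙ a))) ⟩
      ∣ S ∣ + ∣ (λ x → S (x ∙ a)) ∣                      ≡⟨ cong (∣ S ∣ +_) (∣∣-translate S a) ⟩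
      ∣ S ∣ + ∣ S ∣                                      ∎
      where
      open ≡-Reasoning
      disjoint : ∀ x → 𝟙 (S x ∨ S (x ∙ a)) ≡ 𝟙 (S x) + 𝟙 (S (x ∙ a))
      disjoint x with S x in x∈S | S (x ∙ a) in xa∈S
      ... | false | _     = refl
      ... | true  | false = refl
      ... | true  | true  = contradiction (subst (T ∘ S) x∙xa≡a (S-closed x (x ∙ a) (from T-≡ x∈S) (from T-≡ xa∈S))) a∉S
        where
        x∙xa≡a : x ∙ (x ∙ a) ≡ a
        x∙xa≡a = trans (solve 2 (λ x a → x ⊕ (x ⊕ a) ⊜ (a ⊕ x) ⊕ x) refl x a) (∙-cancelʳ a x)

  module _ {U : Fin n → Bool} (U-closed : Closed U) where

    -- Grow S inside U by adjoining elements of U ∖ S, doubling ∣ S ∣; k bounds the number of steps left.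
    ∣∣≡2^-from : ∀ k {S} j → Closed S → S ⊆ U → ∣ S ∣ ≡ 2 ^ j → ∣ U ∣ ≤ ∣ S ∣ + k →
                 ∃ λ d → ∣ U ∣ ≡ 2 ^ d
    ∣∣≡2^-from k {S} j S-closed S⊆U ∣S∣≡2^j ∣U∣≤ with any? (λ a → T? (U a) ×-dec ¬? (T? (S a)))
    ... | no ∄a = j , trans (≤-antisym (∣∣-mono-⊆ U⊆S) (∣∣-mono-⊆ S⊆U)) ∣S∣≡2^j
      where
      U⊆S : U ⊆ S
      U⊆S x x∈U with T? (S x)
      ... | yes x∈S = x∈S
      ... | no  x∉S = contradiction (x , x∈U , x∉S) ∄a
    ... | yes (a , a∈U , a∉S) = step k ∣U∣≤
      where
      S′⊆U : adjoin S a ⊆ U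
      S′⊆U = adjoin-⊆ S-closed a U-closed S⊆U a∈U
      ∣S′∣≡2^1+j : ∣ adjoin S a ∣ ≡ 2 ^ suc j
      ∣S′∣≡2^1+j = trans (∣adjoin∣ S-closed a a∉S) (cong₂ _+_ ∣S∣≡2^j (trans ∣S∣≡2^j (sym (+-identityʳ (2 ^ j)))))
      ∣S∣<∣S′∣ : suc ∣ S ∣ ≤ ∣ adjoin S a ∣
      ∣S∣<∣S′∣ = subst (_≤ ∣ adjoin S a ∣) (+-comm ∣ S ∣ 1)
        (subst (∣ S ∣ + 1 ≤_) (sym (∣adjoin∣ S-closed a a∉S)) (+-monoʳ-≤ ∣ S ∣ (subst (1 ≤_) (sym ∣S∣≡2^j) (m^n>0 2 j))))
      step : ∀ k → ∣ U ∣ ≤ ∣ S ∣ + k → ∃ λ d → ∣ U ∣ ≡ 2 ^ d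
      step zero    ∣U∣≤ = contradiction (≤-trans ∣S∣<∣S′∣ (≤-trans (∣∣-mono-⊆ S′⊆U) (subst (∣ U ∣ ≤_) (+-identityʳ ∣ S ∣) ∣U∣≤))) 1+n≰n
      step (suc k) ∣U∣≤ = ∣∣≡2^-from k (suc j) (adjoin-closed S-closed a) S′⊆U ∣S′∣≡2^1+j
        (≤-trans ∣U∣≤ (subst (_≤ ∣ adjoin S a ∣ + k) (sym (+-suc ∣ S ∣ k)) (+-monoˡ-≤ k ∣S∣<∣S′∣)))

    ∃-∣subgroup∣≡2^ : T (U ε) → ∃ λ d → ∣ U ∣ ≡ 2 ^ d
    ∃-∣subgroup∣≡2^ ε∈U = ∣∣≡2^-from ∣ U ∣ 0 ε-closed ε⊆U (∑-δ-one ε) (m≤n+m ∣ U ∣ _)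
      where
      ε-closed : Closed (λ x → ⌊ ε ≟ x ⌋)
      ε-closed x y ε≡x ε≡y = fromWitness (trans (sym (∙-self ε)) (cong₂ _∙_ (toWitness ε≡x) (toWitness ε≡y)))
      ε⊆U : (λ x → ⌊ ε ≟ x ⌋) ⊆ U
      ε⊆U x ε≡x = subst (T ∘ U) (toWitness ε≡x) ε∈U

module FiniteField {order : ℕ} (𝔽 : FiniteField2 order) where

  open import Algebra.Definitions using (Congruent₁)
  open import Algebra.Morphism.Structures using (IsMonoidMonomorphism)
  open import Data.Bool using (true; false; T)
  open import Data.Bool.Properties using (T-≡)
  open import Data.Nat as ℕ using (zero; suc)
  import Data.Nat.Properties as ℕ
  open import Data.Product using (∃; _,_; proj₁; proj₂; map₂)
  open import Function using (Injective)
  open import Function.Bundles using (module Equivalence)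
  open import Relation.Nullary using (¬_; yes; no; contradiction)
  open import Relation.Binary.PropositionalEquality as ≡ using (_≢_)
  open Equivalence using (from)
  open FiniteSums using (countFin≡∑; injective⇒surjective)

  open FiniteField2 𝔽 renaming (_≟_ to _≈?_)
  open FieldNotions 𝔽
  open import Algebra.Properties.CommutativeSemiring.Exp commutativeSemiring using (_^_; ^-congˡ; ^-assocʳ)
  open import Algebra.Solver.CommutativeMonoid +-commutativeMonoid using (solve; _⊕_; _⊜_)
  open import Relation.Binary.Reasoning.Setoid setoid

  x+x≈0 : ∀ x → x + x ≈ 0#
  x+x≈0 x = begin
    x + x               ≈⟨ +-cong (*-identityˡ x) (*-identityˡ x) ⟨
    1# * x + 1# * x     ≈⟨ distribʳ x 1# 1# ⟨
    (1# + 1#) * x       ≈⟨ *-congʳ char2 ⟩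
    0# * x              ≈⟨ zeroˡ x ⟩
    0#                  ∎

  +≈0⇒≈ : ∀ {a b} → a + b ≈ 0# → a ≈ b
  +≈0⇒≈ {a} {b} a+b≈0 = begin
    a                   ≈⟨ +-identityʳ a ⟨
    a + 0#              ≈⟨ +-congˡ (x+x≈0 b) ⟨
    a + (b + b)         ≈⟨ +-assoc a b b ⟨
    (a + b) + b         ≈⟨ +-congʳ a+b≈0 ⟩
    0# + b              ≈⟨ +-identityˡ b ⟩
    b                   ∎

  ≈⇒+≈0 : ∀ {a b} → a ≈ b → a + b ≈ 0#
  ≈⇒+≈0 {b = b} a≈b = trans (+-congʳ a≈b) (x+x≈0 b)

  square-+ : ∀ a b → (a + b) ^ 2 ≈ a ^ 2 + b ^ 2
  square-+ a b = begin
    (a + b) * ((a + b) * 1#)            ≈⟨ *-congˡ (*-identityʳ (a + b)) ⟩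
    (a + b) * (a + b)                   ≈⟨ distribʳ (a + b) a b ⟩
    a * (a + b) + b * (a + b)           ≈⟨ +-cong (distribˡ a a b) (distribˡ b a b) ⟩
    (a * a + a * b) + (b * a + b * b)   ≈⟨ +-congˡ (+-congʳ (*-comm b a)) ⟩
    (a * a + a * b) + (a * b + b * b)   ≈⟨ solve 3 (λ x y z → (x ⊕ y) ⊕ (y ⊕ z) ⊜ (x ⊕ z) ⊕ (y ⊕ y)) refl (a * a) (a * b) (b * b) ⟩
    (a * a + b * b) + (a * b + a * b)   ≈⟨ +-congˡ (x+x≈0 (a * b)) ⟩
    (a * a + b * b) + 0#                ≈⟨ +-identityʳ _ ⟩
    a * a + b * b                       ≈⟨ +-cong (*-congˡ (*-identityʳ a)) (*-congˡ (*-identityʳ b)) ⟨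
    a ^ 2 + b ^ 2                       ∎

  frobenius : ∀ k a b → (a + b) ^ (2 ℕ.^ k) ≈ a ^ (2 ℕ.^ k) + b ^ (2 ℕ.^ k)
  frobenius zero    a b = trans (*-identityʳ (a + b)) (sym (+-cong (*-identityʳ a) (*-identityʳ b)))
  frobenius (suc k) a b = begin
    (a + b) ^ (2 ℕ.* 2 ℕ.^ k)               ≈⟨ ^-assocʳ (a + b) 2 (2 ℕ.^ k) ⟨
    ((a + b) ^ 2) ^ (2 ℕ.^ k)               ≈⟨ ^-congˡ (2 ℕ.^ k) (square-+ a b) ⟩
    (a ^ 2 + b ^ 2) ^ (2 ℕ.^ k)             ≈⟨ frobenius k (a ^ 2) (b ^ 2) ⟩
    (a ^ 2) ^ (2 ℕ.^ k) + (b ^ 2) ^ (2 ℕ.^ k) ≈⟨ +-cong (^-assocʳ a 2 (2 ℕ.^ k)) (^-assocʳ b 2 (2 ℕ.^ k)) ⟩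
    a ^ (2 ℕ.* 2 ℕ.^ k) + b ^ (2 ℕ.* 2 ℕ.^ k) ∎

  pow≡^ : ∀ x n → pow x n ≡ x ^ n
  pow≡^ x zero    = ≡.refl
  pow≡^ x (suc n) = ≡.cong (x *_) (pow≡^ x n)

  pow-cong : ∀ n → Congruent₁ _≈_ (λ x → pow x n)
  pow-cong zero    _   = refl
  pow-cong (suc n) x≈y = *-cong x≈y (pow-cong n x≈y)

  Additive : (Carrier → Carrier) → Set
  Additive g = ∀ a b → g (a + b) ≈ g a + g b

  pow-2^-additive : ∀ {e} k → e ≡ 2 ℕ.^ k → Additive (λ x → pow x e)
  pow-2^-additive k ≡.refl a b = begin
    pow (a + b) (2 ℕ.^ k)                    ≡⟨ pow≡^ (a + b) (2 ℕ.^ k) ⟩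
    (a + b) ^ (2 ℕ.^ k)                      ≈⟨ frobenius k a b ⟩
    a ^ (2 ℕ.^ k) + b ^ (2 ℕ.^ k)            ≡⟨ ≡.cong₂ _+_ (pow≡^ a (2 ℕ.^ k)) (pow≡^ b (2 ℕ.^ k)) ⟨
    pow a (2 ℕ.^ k) + pow b (2 ℕ.^ k)        ∎

  *-additive : ∀ μ {g} → Additive g → Additive (λ x → μ * g x)
  *-additive μ {g} g-add a b = trans (*-congˡ (g-add a b)) (distribˡ μ (g a) (g b))

  +-additive : ∀ {g h} → Additive g → Additive h → Additive (λ x → g x + h x)
  +-additive {g} {h} g-add h-add a b = begin
    g (a + b) + h (a + b)           ≈⟨ +-cong (g-add a b) (h-add a b) ⟩
    (g a + g b) + (h a + h b)       ≈⟨ solve 4 (λ w x y z → (w ⊕ x) ⊕ (y ⊕ z) ⊜ (w ⊕ y) ⊕ (x ⊕ z)) refl (g a) (g b) (h a) (h b) ⟩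
    (g a + h a) + (g b + h b)       ∎

  additive⇒0↦0 : ∀ {g} → Congruent₁ _≈_ g → Additive g → g 0# ≈ 0#
  additive⇒0↦0 {g} g-cong g-add = begin
    g 0#              ≈⟨ g-cong (+-identityʳ 0#) ⟨
    g (0# + 0#)       ≈⟨ g-add 0# 0# ⟩
    g 0# + g 0#       ≈⟨ x+x≈0 (g 0#) ⟩
    0#                ∎

  additive-injective : ∀ {g} → Additive g → (∀ x → g x ≈ 0# → x ≈ 0#) → ∀ a b → g a ≈ g b → a ≈ b
  additive-injective {g} g-add ker≈0 a b ga≈gb = +≈0⇒≈ (ker≈0 (a + b) (trans (g-add a b) (≈⇒+≈0 ga≈gb)))

  module _ (m s : ℕ) (μ : Carrier) where

    f-additive : Additive (f m s μ)
    f-additive = +-additive (+-additive (pow-2^-additive (s ℕ.+ m) (≡.sym (ℕ.^-distribˡ-+-* 2 s m)))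
                                        (*-additive μ (pow-2^-additive s ≡.refl)))
                            (λ _ _ → refl)

    f-cong : Congruent₁ _≈_ (f m s μ)
    f-cong x≈y = +-cong (+-cong (pow-cong (2 ℕ.^ s ℕ.* 2 ℕ.^ m) x≈y) (*-congˡ (pow-cong (2 ℕ.^ s) x≈y))) x≈y

  *-nonzero : ∀ {x y} → ¬ x ≈ 0# → ¬ y ≈ 0# → ¬ x * y ≈ 0#
  *-nonzero {x} {y} x≉0 y≉0 xy≈0 = y≉0 (begin
    y                   ≈⟨ *-identityˡ y ⟨
    1# * y              ≈⟨ *-congʳ (trans (*-comm (x ⁻¹) x) (inverse x x≉0)) ⟨
    (x ⁻¹ * x) * y      ≈⟨ *-assoc (x ⁻¹) x y ⟩
    x ⁻¹ * (x * y)      ≈⟨ *-congˡ xy≈0 ⟩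
    x ⁻¹ * 0#           ≈⟨ zeroʳ (x ⁻¹) ⟩
    0#                  ∎)

  pow-nonzero : ∀ {x} n → ¬ x ≈ 0# → ¬ pow x n ≈ 0#
  pow-nonzero zero    x≉0 1≈0 = 0≉1 (sym 1≈0)
  pow-nonzero (suc n) x≉0     = *-nonzero x≉0 (pow-nonzero n x≉0)

  *⁻¹≈⇒≈* : ∀ {x y z} → ¬ y ≈ 0# → x * y ⁻¹ ≈ z → x ≈ z * y
  *⁻¹≈⇒≈* {x} {y} {z} y≉0 x/y≈z = begin
    x                   ≈⟨ *-identityʳ x ⟨
    x * 1#              ≈⟨ *-congˡ (trans (*-comm (y ⁻¹) y) (inverse y y≉0)) ⟨
    x * (y ⁻¹ * y)      ≈⟨ *-assoc x (y ⁻¹) y ⟨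
    (x * y ⁻¹) * y      ≈⟨ *-congʳ x/y≈z ⟩
    z * y               ∎

  ≈*⇒*⁻¹≈ : ∀ {x y z} → ¬ y ≈ 0# → x ≈ z * y → x * y ⁻¹ ≈ z
  ≈*⇒*⁻¹≈ {x} {y} {z} y≉0 x≈zy = begin
    x * y ⁻¹            ≈⟨ *-congʳ x≈zy ⟩
    (z * y) * y ⁻¹      ≈⟨ *-assoc z y (y ⁻¹) ⟩
    z * (y * y ⁻¹)      ≈⟨ *-congˡ (inverse y y≉0) ⟩
    z * 1#              ≈⟨ *-identityʳ z ⟩
    z                   ∎

  module _ (m s : ℕ) {μ x : Carrier} (x≉0 : ¬ x ≈ 0#) where

    private
      A B : Carrier
      A = pow x (2 ℕ.^ s ℕ.* 2 ℕ.^ m)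
      B = pow x (2 ℕ.^ s)
      f≈ : f m s μ x ≈ (A + x) + μ * B
      f≈ = solve 3 (λ a b x → (a ⊕ b) ⊕ x ⊜ (a ⊕ x) ⊕ b) refl A (μ * B) x

    root⇒ratio≈ : f m s μ x ≈ 0# → ratio m s x ≈ μ
    root⇒ratio≈ root = ≈*⇒*⁻¹≈ (pow-nonzero (2 ℕ.^ s) x≉0) (+≈0⇒≈ (trans (sym f≈) root))

    ratio≈⇒root : ratio m s x ≈ μ → f m s μ x ≈ 0#
    ratio≈⇒root ratio≈μ = trans f≈ (≈⇒+≈0 (*⁻¹≈⇒≈* (pow-nonzero (2 ℕ.^ s) x≉0) ratio≈μ))

  idx : Carrier → Fin order
  idx c = proj₁ (enum-surj c)

  enum-idx : ∀ c → enum (idx c) ≈ c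
  enum-idx c = proj₂ (enum-surj c)

  idx≡⇒≈ : ∀ {c i} → idx c ≡ i → c ≈ enum i
  idx≡⇒≈ {c} ≡.refl = sym (enum-idx c)

  ≈⇒idx≡ : ∀ {c i} → c ≈ enum i → idx c ≡ i
  ≈⇒idx≡ {c} {i} c≈ei = enum-inj (idx c) i (trans (enum-idx c) c≈ei)

  -- Addition transported to indices along enum, so that additive subgroups can be counted over Fin order.
  _+ᵢ_ : Fin order → Fin order → Fin order
  i +ᵢ j = idx (enum i + enum j)

  0ᵢ : Fin order
  0ᵢ = idx 0#

  enum≈0⇒≡0ᵢ : ∀ {i} → enum i ≈ 0# → i ≡ 0ᵢ
  enum≈0⇒≡0ᵢ ei≈0 = ≡.sym (≈⇒idx≡ (sym ei≈0))

  nonzero⇒≢0ᵢ : ∀ {i} → ¬ enum i ≈ 0# → 0ᵢ ≢ i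
  nonzero⇒≢0ᵢ ei≉0 ≡.refl = ei≉0 (enum-idx 0#)

  enum-isMonoidMonomorphism :
    IsMonoidMonomorphism (record { Carrier = Fin order ; _≈_ = _≡_ ; _∙_ = _+ᵢ_ ; ε = 0ᵢ }) +-rawMonoid enum
  enum-isMonoidMonomorphism = record
    { isMonoidHomomorphism = record
      { isMagmaHomomorphism = record
        { isRelHomomorphism = record { cong = λ { ≡.refl → refl } }
        ; homo              = λ i j → enum-idx (enum i + enum j)
        }
      ; ε-homo = enum-idx 0#
      }
    ; injective = enum-inj _ _
    }

  +ᵢ-isCommutativeMonoid : IsCommutativeMonoid _≡_ _+ᵢ_ 0ᵢ
  +ᵢ-isCommutativeMonoid = isCommutativeMonoid enum-isMonoidMonomorphism +-isCommutativeMonoid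
    where open import Algebra.Morphism.MonoidMonomorphism using (isCommutativeMonoid)

  +ᵢ-self : ∀ i → i +ᵢ i ≡ 0ᵢ
  +ᵢ-self i = ≈⇒idx≡ (trans (x+x≈0 (enum i)) (sym (enum-idx 0#)))

  isZeroB-true : ∀ {x} → x ≈ 0# → isZeroB x ≡ true
  isZeroB-true {x} x≈0 with x ≈? 0#
  ... | yes _   = ≡.refl
  ... | no  x≉0 = contradiction x≈0 x≉0

  isZeroB-false : ∀ {x} → ¬ x ≈ 0# → isZeroB x ≡ false
  isZeroB-false {x} x≉0 with x ≈? 0#
  ... | yes x≈0 = contradiction x≈0 x≉0
  ... | no  _   = ≡.refl

  isZeroB-sound : ∀ {x} → T (isZeroB x) → x ≈ 0#
  isZeroB-sound {x} with x ≈? 0#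
  ... | yes x≈0 = λ _ → x≈0

  isZeroB-complete : ∀ {x} → x ≈ 0# → T (isZeroB x)
  isZeroB-complete x≈0 = from T-≡ (isZeroB-true x≈0)

  module _ {g : Carrier → Carrier} (g-cong : Congruent₁ _≈_ g) (g-add : Additive g) where

    ∃-∣kernel∣≡2^ : ∃ λ d → countFin order (λ i → isZeroB (g (enum i))) ≡ 2 ℕ.^ d
    ∃-∣kernel∣≡2^ = map₂ (≡.trans (countFin≡∑ order _)) (∃-∣subgroup∣≡2^ kernel-closed 0ᵢ∈kernel)
      where
      open BooleanGroup +ᵢ-isCommutativeMonoid +ᵢ-self
      kernel-closed : Closed (λ i → isZeroB (g (enum i)))
      kernel-closed i j i∈ j∈ = isZeroB-complete (begin
        g (enum (i +ᵢ j))          ≈⟨ g-cong (enum-idx (enum i + enum j)) ⟩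
        g (enum i + enum j)        ≈⟨ g-add (enum i) (enum j) ⟩
        g (enum i) + g (enum j)    ≈⟨ +-cong (isZeroB-sound i∈) (isZeroB-sound j∈) ⟩
        0# + 0#                    ≈⟨ +-identityʳ 0# ⟩
        0#                         ∎)
      0ᵢ∈kernel : T (isZeroB (g (enum 0ᵢ)))
      0ᵢ∈kernel = isZeroB-complete (trans (g-cong (enum-idx 0#)) (additive⇒0↦0 g-cong g-add))

  injective⇒permutation : ∀ {g} → (∀ a b → g a ≈ g b → a ≈ b) → IsPermutation g
  injective⇒permutation {g} g-inj = g-inj , surjective
    where
    h : Fin order → Fin order
    h i = idx (g (enum i))
    h-inj : Injective _≡_ _≡_ h
    h-inj {i} {j} hi≡hj = enum-inj i j (g-inj (enum i) (enum j) (trans (idx≡⇒≈ hi≡hj) (enum-idx (g (enum j)))))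
    surjective : ∀ y → ∃ λ x → g x ≈ y
    surjective y with injective⇒surjective h-inj (idx y)
    ... | x , hx≡idx-y = enum x , trans (idx≡⇒≈ hx≡idx-y) (enum-idx y)

module Roots {order : ℕ} (𝔽 : FiniteField2 order) (m s : ℕ) where

  open import Algebra.Properties.Semiring.Sum Data.Nat.Properties.+-*-semiring using (sum-syntax; ∑-distrib-+; sum-cong-≗)
  open import Data.Fin.Properties using (_≟_)
  open import Data.Nat as ℕ using (suc)
  open import Data.Nat.Logarithm using (⌊log₂_⌋; ⌊log₂[2^n]⌋≡n)
  import Data.Nat.Properties as ℕ
  open import Data.Product using (_×_; _,_; proj₁; proj₂)
  open import Function using (_∘_; Injective)
  open import Relation.Nullary using (¬_; yes; no; contradiction)
  import Relation.Binary.PropositionalEquality as ≡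
  open FiniteSums

  open FiniteField2 𝔽 using (_≈_; 0#; enum; refl; sym; trans) renaming (_≟_ to _≈?_)
  open FieldNotions 𝔽
  open FiniteField 𝔽
  open ≡.≡-Reasoning

  -- ρ 0ᵢ is junk (it involves 0⁻¹); every use is weighted by ν 0ᵢ, which vanishes there.
  ρ : Fin order → Fin order
  ρ x = idx (ratio m s (enum x))

  -- By 𝟙-root, nonzeroRoots μ is the number of nonzero roots of f_μ.
  nonzeroRoots : Fin order → ℕ
  nonzeroRoots = fibre (ν 0ᵢ) ρ

  𝟙-nonzero-root : ∀ μ {x} → ¬ enum x ≈ 0# → 𝟙 (isZeroB (f m s (enum μ) (enum x))) ≡ δ (ρ x) μ
  𝟙-nonzero-root μ {x} x≉0 with ρ x ≟ μ
  ... | yes ρx≡μ = ≡.cong 𝟙 (isZeroB-true (ratio≈⇒root m s x≉0 (idx≡⇒≈ ρx≡μ)))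
  ... | no  ρx≢μ = ≡.cong 𝟙 (isZeroB-false (ρx≢μ ∘ ≈⇒idx≡ ∘ root⇒ratio≈ m s x≉0))

  𝟙-root : ∀ μ x → 𝟙 (isZeroB (f m s (enum μ) (enum x))) ≡ δ 0ᵢ x ℕ.+ ν 0ᵢ x ℕ.* δ (ρ x) μ
  𝟙-root μ x with 0ᵢ ≟ x
  ... | yes ≡.refl = ≡.cong 𝟙 (isZeroB-true (trans (f-cong m s (enum μ) (enum-idx 0#))
                                                    (additive⇒0↦0 (f-cong m s (enum μ)) (f-additive m s (enum μ)))))
  ... | no  0ᵢ≢x   = ≡.trans (𝟙-nonzero-root μ (0ᵢ≢x ∘ ≡.sym ∘ enum≈0⇒≡0ᵢ)) (≡.sym (ℕ.+-identityʳ _))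

  kerSize≡1+nonzeroRoots : ∀ μ → kerSize m s (enum μ) ≡ suc (nonzeroRoots μ)
  kerSize≡1+nonzeroRoots μ = begin
    kerSize m s (enum μ)                                          ≡⟨ countFin≡∑ order _ ⟩
    ∑[ x < order ] 𝟙 (isZeroB (f m s (enum μ) (enum x)))          ≡⟨ sum-cong-≗ {order} (𝟙-root μ) ⟩
    ∑[ x < order ] (δ 0ᵢ x ℕ.+ ν 0ᵢ x ℕ.* δ (ρ x) μ)               ≡⟨ ∑-distrib-+ (δ 0ᵢ) (λ x → ν 0ᵢ x ℕ.* δ (ρ x) μ) ⟩
    ∑[ x < order ] δ 0ᵢ x ℕ.+ nonzeroRoots μ                       ≡⟨ ≡.cong (ℕ._+ nonzeroRoots μ) (∑-δ-one 0ᵢ) ⟩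
    suc (nonzeroRoots μ)                                           ∎

  kerSize≤2^Ms : ∀ μ → kerSize m s (enum μ) ℕ.≤ 2 ℕ.^ Ms m s
  kerSize≤2^Ms μ with ∃-∣kernel∣≡2^ (f-cong m s (enum μ)) (f-additive m s (enum μ))
  ... | d , ∣ker∣≡2^d = ≡.subst (ℕ._≤ 2 ℕ.^ Ms m s) (≡.sym ∣ker∣≡2^d) (ℕ.^-monoʳ-≤ 2 d≤Ms)
    where
    d≤Ms : d ℕ.≤ Ms m s
    d≤Ms = ≡.subst (ℕ._≤ Ms m s) (≡.trans (≡.cong ⌊log₂_⌋ ∣ker∣≡2^d) (⌊log₂[2^n]⌋≡n d))
                   (≤-maxFin order (λ i → kerDim m s (enum i)) μ)

  nonzeroRoots≤2^Ms∸1 : ∀ μ → nonzeroRoots μ ℕ.≤ 2 ℕ.^ Ms m s ℕ.∸ 1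
  nonzeroRoots≤2^Ms∸1 μ = ℕ.∸-monoˡ-≤ 1 (≡.subst (ℕ._≤ 2 ℕ.^ Ms m s) (kerSize≡1+nonzeroRoots μ) (kerSize≤2^Ms μ))

  ∑-nonzeroRoots+1≡order : ∑[ μ < order ] nonzeroRoots μ ℕ.+ 1 ≡ order
  ∑-nonzeroRoots+1≡order = ≡.trans (≡.cong (ℕ._+ 1) (∑-fibre-total (ν 0ᵢ) ρ)) (∑-ν+1≡n 0ᵢ)

  noNonzeroRoots⇒permutation : ∀ μ → nonzeroRoots μ ≡ 0 → IsPermutation (f m s (enum μ))
  noNonzeroRoots⇒permutation μ none = injective⇒permutation (additive-injective (f-additive m s (enum μ)) trivial-kernel)
    where
    trivial-kernel : ∀ a → f m s (enum μ) a ≈ 0# → a ≈ 0#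
    trivial-kernel a root with a ≈? 0#
    ... | yes a≈0 = a≈0
    ... | no  a≉0 = contradiction (≡.subst (1 ℕ.≤_) none 1≤nonzeroRoots) λ ()
      where
      idx-a≉0 : ¬ enum (idx a) ≈ 0#
      idx-a≉0 = a≉0 ∘ trans (sym (enum-idx a))
      root-counted : ν 0ᵢ (idx a) ℕ.* δ (ρ (idx a)) μ ≡ 1
      root-counted = ≡.cong₂ ℕ._*_ (ν-≢ (nonzero⇒≢0ᵢ idx-a≉0))
        (≡.trans (≡.sym (𝟙-nonzero-root μ idx-a≉0)) (≡.cong 𝟙 (isZeroB-true (trans (f-cong m s (enum μ) (enum-idx a)) root))))
      1≤nonzeroRoots : 1 ℕ.≤ nonzeroRoots μ
      1≤nonzeroRoots = ≡.subst (ℕ._≤ nonzeroRoots μ) root-counted (≤-∑ (λ x → ν 0ᵢ x ℕ.* δ (ρ x) μ) (idx a))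

  curvePair⇒1≤sameFibre : ∀ x y → CurvePair m s (enum x) (enum y) → 1 ℕ.≤ sameFibre (ν 0ᵢ) ρ x y
  curvePair⇒1≤sameFibre x y (x≉0 , y≉0 , x≉y , ratio≈) = ≡.subst (1 ℕ.≤_) (≡.sym weight≡1) (ℕ.s≤s ℕ.z≤n)
    where
    ρy≡ρx : ρ y ≡ ρ x
    ρy≡ρx = ≈⇒idx≡ (trans (sym ratio≈) (sym (enum-idx (ratio m s (enum x)))))
    weight≡1 : sameFibre (ν 0ᵢ) ρ x y ≡ 1
    weight≡1 = ≡.cong₂ ℕ._*_ (ν-≢ (nonzero⇒≢0ᵢ x≉0))
      (≡.cong₂ ℕ._*_ (≡.cong₂ ℕ._*_ (ν-≢ (nonzero⇒≢0ᵢ y≉0)) (≡.trans (≡.cong (λ i → δ i (ρ x)) ρy≡ρx) (δ-refl (ρ x))))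
                     (ν-≢ {i = x} {y} λ { ≡.refl → x≉y refl }))

  curvePairs≤∑-nonzeroRoots² : ∀ {N} (pairs : Fin N → Fin order × Fin order) → Injective _≡_ _≡_ pairs →
    (∀ i → CurvePair m s (enum (proj₁ (pairs i))) (enum (proj₂ (pairs i)))) →
    N ℕ.≤ ∑[ μ < order ] (nonzeroRoots μ ℕ.* (nonzeroRoots μ ℕ.∸ 1))
  curvePairs≤∑-nonzeroRoots² pairs pairs-inj curve =
    ℕ.≤-trans (injective⇒≤-∑∑ pairs pairs-inj (sameFibre (ν 0ᵢ) ρ) (λ i → curvePair⇒1≤sameFibre _ _ (curve i)))
              (ℕ.≤-reflexive (∑∑-sameFibre (ν 0ᵢ) ρ (ν≤1 0ᵢ)))

open import Data.Bool using (Bool)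
open import Data.Nat using (_+_; _*_; _^_; _∸_; _≤_; _≡ᵇ_)
open import Data.Nat.Properties using (≤-trans; +-monoˡ-≤; ≡ᵇ⇒≡)
open import Data.Product using (Σ; ∃; _×_; _,_; proj₁; proj₂)
open FiniteSums using (enumerate; ∑[c*[c∸1]]+D≤#zeros*D)

proposition4p5 : (m s : ℕ) → 1 ≤ m → 1 ≤ s →
    (F : FiniteField2 ((2 ^ m) ^ 3)) →
    (N : ℕ) →
    (pairs : Fin N → Fin ((2 ^ m) ^ 3) × Fin ((2 ^ m) ^ 3)) →
    (∀ i j → pairs i ≡ pairs j → i ≡ j) →
    (∀ i → FieldNotions.CurvePair F m s
             (FiniteField2.enum F (proj₁ (pairs i)))
             (FiniteField2.enum F (proj₂ (pairs i)))) →
    ∃ λ (K : ℕ) →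
      (N + (2 ^ FieldNotions.Ms F m s ∸ 1) ≤ K * (2 ^ FieldNotions.Ms F m s ∸ 1))
      × (Σ (Fin K → Fin ((2 ^ m) ^ 3)) λ g →
           (∀ i j → g i ≡ g j → i ≡ j)
           × (∀ i → FieldNotions.IsPermutation F
                      (FieldNotions.f F m s (FiniteField2.enum F (g i)))))
proposition4p5 m s _ _ F N pairs pairs-inj curve =
  let g , g-inj , g-permuting = enumerate q³ permuting in
  countFin q³ permuting , bound , g , (λ _ _ → g-inj) ,
  λ i → noNonzeroRoots⇒permutation (g i) (≡ᵇ⇒≡ _ 0 (g-permuting i))
  where
  open Roots F m s
  q³ D : ℕ
  q³ = (2 ^ m) ^ 3
  D  = 2 ^ FieldNotions.Ms F m s ∸ 1
  permuting : Fin q³ → Bool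
  permuting μ = nonzeroRoots μ ≡ᵇ 0
  bound : N + D ≤ countFin q³ permuting * D
  bound = ≤-trans (+-monoˡ-≤ D (curvePairs≤∑-nonzeroRoots² pairs (pairs-inj _ _) curve))
                  (∑[c*[c∸1]]+D≤#zeros*D nonzeroRoots D nonzeroRoots≤2^Ms∸1 ∑-nonzeroRoots+1≡order)
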